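{- Let $\mathcal{A}=(Q,E,s,F)$ be a DFA. Then the maximum co-lex relation $\le_{\mathcal{A},\{s\}}$ is equal to $\preceq_\mathcal{A}$, and it is also the maximum co-lex order on $\mathcal{A}$.
   Context: $\Sigma$ is a finite alphabet with a fixed total order $\preceq$, extended co-lexicographically to $\Sigma^*$ ($\alpha\preceq\beta$ iff reverse of $\alpha$ is lexicographically $\le$ reverse of $\beta$; $\prec$ strict). A DFA $\mathcal{A}=(Q,E,s,F)$ is an NFA ($E\subseteq Q\times Q\times\Sigma$) in which each state has at most one outgoing edge per letter; every state is reachable from $s$ and can reach a final state. $I_u$ is the set of strings readable from $s$ to $u$. Let $\#,@\notin\Sigma$ with $\#\prec @\prec a$ for all $a\in\Sigma$. $\lambda(v)$ is the set of labels of edges entering $v$ if any, else $\{\#\}$, with $@$ added if $v=s$. $\lambda(u)\,\angle\,\lambda(v)$ iff $x\preceq y$ for all $x\in\lambda(u),y\in\lambda(v)$. A co-lex relation is a reflexive $R\subseteq Q\times Q$ with (Axiom 1) $u\neq v$, $(u,v)\in R$ implies $\lambda(u)\,\angle\,\lambda(v)$; (Axiom 2) for $(u',u,a),(v',v,a)\in E$ with $u\neq v$, $(u,v)\in R$, $(u',v')\in R$; a co-lex order is one that is a partial order. $\le_{\mathcal{A},\{s\}}$ is the co-lex relation containing all co-lex relations; the maximum co-lex order is a co-lex order containing all co-lex orders. On $\{I_u\}$, $\preceq$ is reflexive with, for $I_u\neq I_v$: $I_u\prec I_v$ iff for all $\alpha\in I_u,\beta\in I_v$ with $\{\alpha,\beta\}\not\subseteq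 I_u\cap I_v$, $\alpha\prec\beta$. $u\preceq_\mathcal{A}v$ iff $I_u\preceq I_v$. -}

module Defs where

open import Data.Nat using (ℕ)
open import Data.Fin using (Fin)
import Data.Fin as Fin
open import Data.List using (List; []; _∷_; reverse)
open import Data.List.Relation.Binary.Lex.Core using (Lex-<)
open import Data.Product using (Σ; ∃; _×_)
open import Data.Sum using (_⊎_)
open import Relation.Nullary using (¬_)
open import Relation.Binary.PropositionalEquality using (_≡_; _≢_)
open import Function.Bundles using (_⇔_)

-- The alphabet Σ is Fin k, totally ordered by the usual order on Fin.
-- Words are lists, read left to right.

_≺ᶜ_ : {k : ℕ} → List (Fin k) → List (Fin k) → Set
α ≺ᶜ β = Lex-< _≡_ Fin._<_ (reverse α) (reverse β)

data Reads {k n : ℕ} (E : Fin n → Fin n → Fin k → Set) :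
           Fin n → List (Fin k) → Fin n → Set where
  ε    : ∀ {u} → Reads E u [] u
  step : ∀ {u u₁ v a w} → E u u₁ a → Reads E u₁ w v → Reads E u (a ∷ w) v

-- A DFA over Σ = Fin k with state set Q = Fin n.
-- E u v a means there is an edge (u , v , a) from u to v labelled a.
record DFA (k n : ℕ) : Set₁ where
  field
    E             : Fin n → Fin n → Fin k → Set
    s             : Fin n
    F             : Fin n → Set
    deterministic : ∀ {u v w a} → E u v a → E u w a → v ≡ w
    reachable     : ∀ u → ∃ λ w → Reads E s w u
    coreachable   : ∀ u → Σ (Fin n) λ f → Σ (List (Fin k)) λ w → F f × Reads E u w f

-- Extended labels: # ≺ @ ≺ a for every a ∈ Σ.
data Lab (k : ℕ) : Set where
  hash : Lab k
  at   : Lab k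
  sym  : Fin k → Lab k

data _≤L_ {k : ℕ} : Lab k → Lab k → Set where
  hash≤   : ∀ {y} → hash ≤L y
  at≤at   : at ≤L at
  at≤sym  : ∀ {a} → at ≤L sym a
  sym≤sym : ∀ {a b} → a Fin.≤ b → sym a ≤L sym b

Rel : ℕ → Set₁
Rel n = Fin n → Fin n → Set

module _ {k n : ℕ} (A : DFA k n) where
  open DFA A

  InLambda : Fin n → Lab k → Set
  InLambda v x =
      (Σ (Fin k) λ a → x ≡ sym a × Σ (Fin n) λ u → E u v a)
    ⊎ ((x ≡ hash) × (∀ u a → ¬ E u v a))
    ⊎ ((x ≡ at) × (v ≡ s))

  LamAngle : Fin n → Fin n → Set
  LamAngle u v = ∀ x y → InLambda u x → InLambda v y → x ≤L y

  IsCoLexRel : Rel n → Set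
  IsCoLexRel R =
      (∀ u → R u u)
    × (∀ u v → u ≢ v → R u v → LamAngle u v)
    × (∀ u' u v' v a → E u' u a → E v' v a → u ≢ v → R u v → R u' v')

  IsPartialOrder : Rel n → Set
  IsPartialOrder R =
      (∀ u → R u u)
    × (∀ u v → R u v → R v u → u ≡ v)
    × (∀ u v w → R u v → R v w → R u w)

  IsCoLexOrder : Rel n → Set
  IsCoLexOrder R = IsCoLexRel R × IsPartialOrder R

  IsMaxCoLexRel : Rel n → Set₁
  IsMaxCoLexRel R = IsCoLexRel R × (∀ R' → IsCoLexRel R' → ∀ u v → R' u v → R u v)

  IsMaxCoLexOrder : Rel n → Set₁
  IsMaxCoLexOrder R = IsCoLexOrder R × (∀ R' → IsCoLexOrder R' → ∀ u v → R' u v → R u v)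

  I : Fin n → List (Fin k) → Set
  I u w = Reads E s w u

  _⪯A_ : Rel n
  u ⪯A v =
      (∀ w → I u w ⇔ I v w)
    ⊎ (∀ α β → I u α → I v β → ¬ (I v α × I u β) → α ≺ᶜ β)

-- In a DFA a word reaches at most one state, so the sets I_u are pairwise
-- disjoint and u ⪯A v says: u = v, or every word reaching u is co-lex below
-- every word reaching v (u ≺A v).  This relation is co-lex: the last letter
-- of a word reaching u lies in λ(u), and co-lex comparison of α a and β a
-- reduces to that of α and β.  It contains every co-lex relation R: given
-- R u v with u ≠ v, compare α ∈ I_u and β ∈ I_v from the end.  Axiom 1 orders
-- their last letters; if these agree, Axiom 2 moves R to the two predecessor
-- states, which are distinct by determinism, so induction on the reversed
-- words gives α ≺ β.  Hence ⪯A is the maximum co-lex relation, and since ≺A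
-- is a strict order it is a partial order as well.
module Submission where

open import Defs
open import Data.Nat using (ℕ)
open import Data.Fin using (Fin; _≟_)
import Data.Fin as Fin
import Data.Fin.Properties as Fin
import Data.Nat.Properties as ℕ
open import Data.List using (List; []; _∷_; [_]; reverse; reverseAcc; _∷ʳ_)
open import Data.List.Properties using (reverse-++)
open import Data.List.Relation.Binary.Lex.Strict
  using (Lex-<; halt; this; next; xs≮[]; <-isStrictPartialOrder)
open import Data.Product using (_×_; _,_; proj₁; proj₂)
open import Data.Sum using (_⊎_; inj₁; inj₂)
open import Data.Empty using (⊥-elim)
open import Function.Bundles using (_⇔_; mk⇔; Equivalence)
open import Relation.Binary.Structures using (IsStrictPartialOrder)
open import Relation.Binary.Definitions using (tri<; tri≈; tri>)
open import Relation.Nullary using (¬_; yes; no; contradiction)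
open import Relation.Binary.PropositionalEquality
  using (_≡_; _≢_; refl; subst₂)

private
  module LexFin {k : ℕ} =
    IsStrictPartialOrder (<-isStrictPartialOrder (Fin.<-isStrictPartialOrder {k}))

≺ᶜ-asym : ∀ {k} {α β : List (Fin k)} → α ≺ᶜ β → ¬ β ≺ᶜ α
≺ᶜ-asym = LexFin.asym

≺ᶜ-trans : ∀ {k} {α β γ : List (Fin k)} → α ≺ᶜ β → β ≺ᶜ γ → α ≺ᶜ γ
≺ᶜ-trans = LexFin.trans

≺ᶜ-∷ʳ⁻ : ∀ {k} {α β : List (Fin k)} {a b} → (α ∷ʳ a) ≺ᶜ (β ∷ʳ b) →
         Lex-< _≡_ Fin._<_ (a ∷ reverse α) (b ∷ reverse β)
≺ᶜ-∷ʳ⁻ {α = α} {β} {a} {b} =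
  subst₂ (Lex-< _≡_ Fin._<_) (reverse-++ α [ a ]) (reverse-++ β [ b ])

module _ {k n : ℕ} (A : DFA k n) where
  open DFA A

  Reads-deterministic : ∀ {x w u v} → Reads E x w u → Reads E x w v → u ≡ v
  Reads-deterministic ε ε = refl
  Reads-deterministic (step e r) (step e′ r′) with deterministic e e′
  ... | refl = Reads-deterministic r r′

  Reads-∷ʳ : ∀ {x α u′ u a} → Reads E x α u′ → E u′ u a → Reads E x (α ∷ʳ a) u
  Reads-∷ʳ ε e = step e ε
  Reads-∷ʳ (step e₁ r) e = step e₁ (Reads-∷ʳ r e)

  -- ReadsRev u ρ: the reversal of ρ is read from s to u, so that structural
  -- recursion on it inspects words from their last letter backwards.
  data ReadsRev : Fin n → List (Fin k) → Set where
    start  : ReadsRev s []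
    extend : ∀ {u′ u a ρ} → ReadsRev u′ ρ → E u′ u a → ReadsRev u (a ∷ ρ)

  Reads⇒ReadsRev : ∀ {x ρ w v} → ReadsRev x ρ → Reads E x w v → ReadsRev v (reverseAcc ρ w)
  Reads⇒ReadsRev back ε = back
  Reads⇒ReadsRev back (step e r) = Reads⇒ReadsRev (extend back e) r

  I⇒ReadsRev : ∀ {u w} → I A u w → ReadsRev u (reverse w)
  I⇒ReadsRev = Reads⇒ReadsRev start

  no-incoming⇒≡s : ∀ {v} → (∀ u a → ¬ E u v a) → v ≡ s
  no-incoming⇒≡s {v} none = first-state (I⇒ReadsRev (proj₂ (reachable v)))
    where
    first-state : ∀ {ρ} → ReadsRev v ρ → v ≡ s
    first-state start = refl
    first-state (extend _ e) = contradiction e (none _ _)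

  _≺A_ : Rel n
  u ≺A v = ∀ α β → I A u α → I A v β → α ≺ᶜ β

  ≺A-asym : ∀ {u v} → u ≺A v → ¬ v ≺A u
  ≺A-asym {u} {v} u≺v v≺u =
    let (α , α∈Iu) = reachable u ; (β , β∈Iv) = reachable v
    in ≺ᶜ-asym {α = α} {β} (u≺v α β α∈Iu β∈Iv) (v≺u β α β∈Iv α∈Iu)

  ≺A-trans : ∀ {u v w} → u ≺A v → v ≺A w → u ≺A w
  ≺A-trans {v = v} u≺v v≺w α γ α∈Iu γ∈Iw =
    let (β , β∈Iv) = reachable v
    in ≺ᶜ-trans {α = α} {β} {γ} (u≺v α β α∈Iu β∈Iv) (v≺w β γ β∈Iv γ∈Iw)

  ≮A-s : ∀ {u} → ¬ u ≺A s
  ≮A-s {u} u≺s = let (α , α∈Iu) = reachable u in xs≮[] (u≺s α [] α∈Iu ε)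

  ≺A-∷ʳ : ∀ {u′ u v′ v a b α β} → u ≺A v → E u′ u a → E v′ v b →
           I A u′ α → I A v′ β → Lex-< _≡_ Fin._<_ (a ∷ reverse α) (b ∷ reverse β)
  ≺A-∷ʳ {α = α} {β} u≺v e e′ α∈Iu′ β∈Iv′ = ≺ᶜ-∷ʳ⁻ {α = α} {β} (u≺v _ _ (Reads-∷ʳ α∈Iu′ e) (Reads-∷ʳ β∈Iv′ e′))

  ≺A-predecessors : ∀ {u′ u v′ v a b} → u ≺A v → E u′ u a → E v′ v b →
                    a Fin.< b ⊎ (a ≡ b × u′ ≺A v′)
  ≺A-predecessors {u′} {v′ = v′} {a = a} {b} u≺v e e′ with Fin.<-cmp a b
  ... | tri< a<b _ _ = inj₁ a<b
  ... | tri≈ _ refl _ = inj₂ (refl , λ α β α∈Iu′ β∈Iv′ → tail (≺A-∷ʳ u≺v e e′ α∈Iu′ β∈Iv′))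
    where
    tail : ∀ {ρ σ} → Lex-< _≡_ Fin._<_ (a ∷ ρ) (a ∷ σ) → Lex-< _≡_ Fin._<_ ρ σ
    tail (this a<a) = contradiction a<a (Fin.<-irrefl refl)
    tail (next _ ρ<σ) = ρ<σ
  ... | tri> _ _ b<a with ≺A-∷ʳ u≺v e e′ (proj₂ (reachable u′)) (proj₂ (reachable v′))
  ...   | this a<b = contradiction b<a (Fin.<-asym a<b)
  ...   | next refl _ = contradiction b<a (Fin.<-irrefl refl)

  ≺A⇒LamAngle : ∀ {u v} → u ≺A v → LamAngle A u v
  ≺A⇒LamAngle u≺v _ _ (inj₂ (inj₁ (refl , _))) _ = hash≤
  ≺A⇒LamAngle u≺v _ _ _ (inj₂ (inj₁ (refl , none))) with no-incoming⇒≡s none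
  ... | refl = ⊥-elim (≮A-s u≺v)
  ≺A⇒LamAngle u≺v _ _ _ (inj₂ (inj₂ (refl , refl))) = ⊥-elim (≮A-s u≺v)
  ≺A⇒LamAngle u≺v _ _ (inj₂ (inj₂ (refl , refl))) (inj₁ (_ , refl , _)) = at≤sym
  ≺A⇒LamAngle u≺v _ _ (inj₁ (_ , refl , _ , e)) (inj₁ (_ , refl , _ , e′))
    with ≺A-predecessors u≺v e e′
  ... | inj₁ a<b = sym≤sym (ℕ.<⇒≤ a<b)
  ... | inj₂ (refl , _) = sym≤sym Fin.≤-refl

  LamAngle-edges : ∀ {u′ u v′ v a b} → LamAngle A u v → E u′ u a → E v′ v b → a Fin.≤ b
  LamAngle-edges {a = a} {b} angle e e′
    with angle (sym a) (sym b) (inj₁ (a , refl , _ , e)) (inj₁ (b , refl , _ , e′))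
  ... | sym≤sym a≤b = a≤b

  ¬LamAngle-edge-s : ∀ {u′ u a} → LamAngle A u s → ¬ E u′ u a
  ¬LamAngle-edge-s {a = a} angle e
    with angle (sym a) at (inj₁ (a , refl , _ , e)) (inj₂ (inj₂ (refl , refl)))
  ... | ()

  I-injective : ∀ {u v} → (∀ w → I A u w ⇔ I A v w) → u ≡ v
  I-injective {u} Iu=Iv =
    let (w , w∈Iu) = reachable u in Reads-deterministic w∈Iu (Equivalence.to (Iu=Iv w) w∈Iu)

  ⪯A⇔≡⊎≺A : ∀ {u v} → _⪯A_ A u v ⇔ (u ≡ v ⊎ u ≺A v)
  ⪯A⇔≡⊎≺A {u} {v} = mk⇔ to from
    where
    to : _⪯A_ A u v → u ≡ v ⊎ u ≺A v
    to (inj₁ Iu=Iv) = inj₁ (I-injective Iu=Iv)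
    to (inj₂ ordered) with u ≟ v
    ... | yes u≡v = inj₁ u≡v
    ... | no u≢v = inj₂ λ α β α∈Iu β∈Iv →
            ordered α β α∈Iu β∈Iv λ (α∈Iv , _) → u≢v (Reads-deterministic α∈Iu α∈Iv)
    from : u ≡ v ⊎ u ≺A v → _⪯A_ A u v
    from (inj₁ refl) = inj₁ λ _ → mk⇔ (λ w∈I → w∈I) (λ w∈I → w∈I)
    from (inj₂ u≺v) = inj₂ λ α β α∈Iu β∈Iv _ → u≺v α β α∈Iu β∈Iv

  ⪯A-isCoLexRel : IsCoLexRel A (_⪯A_ A)
  ⪯A-isCoLexRel = reflexive , axiom₁ , axiom₂
    where
    open Equivalence
    reflexive : ∀ u → _⪯A_ A u u
    reflexive u = from ⪯A⇔≡⊎≺A (inj₁ refl)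
    axiom₁ : ∀ u v → u ≢ v → _⪯A_ A u v → LamAngle A u v
    axiom₁ u v u≢v u⪯v with to ⪯A⇔≡⊎≺A u⪯v
    ... | inj₁ u≡v = contradiction u≡v u≢v
    ... | inj₂ u≺v = ≺A⇒LamAngle u≺v
    axiom₂ : ∀ u′ u v′ v a → E u′ u a → E v′ v a → u ≢ v → _⪯A_ A u v → _⪯A_ A u′ v′
    axiom₂ u′ u v′ v a e e′ u≢v u⪯v with to ⪯A⇔≡⊎≺A u⪯v
    ... | inj₁ u≡v = contradiction u≡v u≢v
    ... | inj₂ u≺v with ≺A-predecessors u≺v e e′
    ...   | inj₁ a<a = contradiction a<a (Fin.<-irrefl refl)
    ...   | inj₂ (_ , u′≺v′) = from ⪯A⇔≡⊎≺A (inj₂ u′≺v′)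

  module _ {R : Rel n} (isCoLex : IsCoLexRel A R) where
    private
      axiom₁ = proj₁ (proj₂ isCoLex)
      axiom₂ = proj₂ (proj₂ isCoLex)

    CoLexRel⇒Lex-< : ∀ {u v ρ σ} → ReadsRev u ρ → ReadsRev v σ → R u v → u ≢ v →
                     Lex-< _≡_ Fin._<_ ρ σ
    CoLexRel⇒Lex-< start start _ s≢s = contradiction refl s≢s
    CoLexRel⇒Lex-< start (extend _ _) _ _ = halt
    CoLexRel⇒Lex-< (extend _ e) start Rus u≢s =
      contradiction e (¬LamAngle-edge-s (axiom₁ _ _ u≢s Rus))
    CoLexRel⇒Lex-< {u} {v} (extend {u′} {a = a} ρ e) (extend {v′} {a = b} σ e′) Ruv u≢v
      with a ≟ b
    ... | no a≢b = this (Fin.≤∧≢⇒< (LamAngle-edges (axiom₁ u v u≢v Ruv) e e′) a≢b)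
    ... | yes refl with u′ ≟ v′
    ...   | yes refl = contradiction (deterministic e e′) u≢v
    ...   | no u′≢v′ = next refl (CoLexRel⇒Lex-< ρ σ (axiom₂ u′ u v′ v a e e′ u≢v Ruv) u′≢v′)

    CoLexRel⊆⪯A : ∀ u v → R u v → _⪯A_ A u v
    CoLexRel⊆⪯A u v Ruv with u ≟ v
    ... | yes u≡v = Equivalence.from ⪯A⇔≡⊎≺A (inj₁ u≡v)
    ... | no u≢v = Equivalence.from ⪯A⇔≡⊎≺A (inj₂ λ α β α∈Iu β∈Iv →
            CoLexRel⇒Lex-< (I⇒ReadsRev α∈Iu) (I⇒ReadsRev β∈Iv) Ruv u≢v)

  ⪯A-isPartialOrder : IsPartialOrder A (_⪯A_ A)
  ⪯A-isPartialOrder = proj₁ ⪯A-isCoLexRel , antisym , trans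
    where
    open Equivalence
    antisym : ∀ u v → _⪯A_ A u v → _⪯A_ A v u → u ≡ v
    antisym u v u⪯v v⪯u with to ⪯A⇔≡⊎≺A u⪯v | to ⪯A⇔≡⊎≺A v⪯u
    ... | inj₁ u≡v | _ = u≡v
    ... | inj₂ _ | inj₁ refl = refl
    ... | inj₂ u≺v | inj₂ v≺u = contradiction v≺u (≺A-asym u≺v)
    trans : ∀ u v w → _⪯A_ A u v → _⪯A_ A v w → _⪯A_ A u w
    trans u v w u⪯v v⪯w with to ⪯A⇔≡⊎≺A u⪯v | to ⪯A⇔≡⊎≺A v⪯w
    ... | inj₁ refl | _ = v⪯w
    ... | inj₂ _ | inj₁ refl = u⪯v
    ... | inj₂ u≺v | inj₂ v≺w = from ⪯A⇔≡⊎≺A (inj₂ (≺A-trans u≺v v≺w))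

lemma17 : ∀ {k n : ℕ} (A : DFA k n)
          → IsMaxCoLexRel A (_⪯A_ A)
          × IsMaxCoLexOrder A (_⪯A_ A)
          × (∀ R → IsMaxCoLexRel A R → ∀ u v → R u v ⇔ _⪯A_ A u v)
lemma17 A =
    (⪯A-isCoLexRel A , λ _ isCoLex → CoLexRel⊆⪯A A isCoLex)
  , ((⪯A-isCoLexRel A , ⪯A-isPartialOrder A) ,
     λ _ isCoLexOrder → CoLexRel⊆⪯A A (proj₁ isCoLexOrder))
  , λ R (isCoLex , maximal) u v →
      mk⇔ (CoLexRel⊆⪯A A isCoLex u v) (maximal (_⪯A_ A) (⪯A-isCoLexRel A) u v)
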